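{- Let $j$ be a positive integer and let $f_{O_j,2}(3)$ be the number of $2$-element subsets $\{n_1,n_2\}\subseteq\{1,\ldots,j\}$ with $\frac{2n_1-1}{j}+\frac{2n_2-1}{j}=3$. Then $$f_{O_j,2}(3)=\frac{1}{8}\Bigl((-1)^{1+j}-1+(-i)^j+i^j+(-1)^j j+j\Bigr),$$ where $i$ is the imaginary unit. -}

module Defs where

open import Data.Nat as ℕ using (ℕ; zero; suc; _∸_; NonZero)
open import Data.Integer as ℤ using (ℤ; +_)
open import Data.Rational as ℚ using (ℚ; _/_)
open import Data.Rational.Properties as ℚP using ()
open import Data.List using (List; map; concatMap; filter; length; upTo)
open import Data.Product using (_×_; _,_; proj₁; proj₂)
open import Relation.Binary.PropositionalEquality using (_≡_)

oneTo : ℕ → List ℕ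
oneTo n = map suc (upTo n)

-- All 2-element subsets {n₁, n₂} ⊆ {1,…,j}, each listed once as (n₁ , n₂) with n₁ < n₂.
twoSubsets : ℕ → List (ℕ × ℕ)
twoSubsets j = concatMap (λ n₂ → map (λ n₁ → (n₁ , n₂)) (oneTo (n₂ ∸ 1))) (oneTo j)

pt : (j : ℕ) → .{{NonZero j}} → ℕ → ℚ
pt j n = (+ (2 ℕ.* n) ℤ.- ℤ.1ℤ) / j

f : (j : ℕ) → .{{NonZero j}} → ℕ
f j = length (filter (λ p → (pt j (proj₁ p) ℚ.+ pt j (proj₂ p)) ℚP.≟ (+ 3 / 1)) (twoSubsets j))

-- Gaussian integers ℤ[i] ⊆ ℂ, enough to evaluate the right-hand side exactly.
record ℤ[i] : Set where
  constructor _+_i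
  field
    re : ℤ
    im : ℤ
open ℤ[i] public

infixl 6 _⊕_ _⊖_
infixl 7 _⊗_

_⊕_ : ℤ[i] → ℤ[i] → ℤ[i]
(a + b i) ⊕ (c + d i) = (a ℤ.+ c) + (b ℤ.+ d) i

⊝_ : ℤ[i] → ℤ[i]
⊝ (a + b i) = (ℤ.- a) + (ℤ.- b) i

_⊖_ : ℤ[i] → ℤ[i] → ℤ[i]
x ⊖ y = x ⊕ (⊝ y)

_⊗_ : ℤ[i] → ℤ[i] → ℤ[i]
(a + b i) ⊗ (c + d i) = (a ℤ.* c ℤ.- b ℤ.* d) + (a ℤ.* d ℤ.+ b ℤ.* c) i

_^ᵍ_ : ℤ[i] → ℕ → ℤ[i]
x ^ᵍ zero = (+ 1) + (+ 0) i
x ^ᵍ suc n = x ⊗ (x ^ᵍ n)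

ι : ℕ → ℤ[i]
ι n = (+ n) + (+ 0) i

𝕚 : ℤ[i]
𝕚 = (+ 0) + (+ 1) i

-1ᵍ : ℤ[i]
-1ᵍ = ⊝ ι 1

{-# OPTIONS --safe #-}
-- A pair {n₁, n₂} is counted exactly when 2(n₁ + n₂) = 3j + 2.  For odd j this is impossible by
-- parity.  For even j put s = 3j/2 + 1, which exceeds j; the pairs n₁ < n₂ ≤ j with n₁ + n₂ = s are
-- indexed by ⌊s/2⌋ < n₂ ≤ j, so there are j - ⌊s/2⌋ of them: k for j = 4k + 2 and k + 1 for j = 4k + 4.
-- On the other side the powers of -1, i and -i only depend on j mod 4, and the right-hand side comes
-- out as 0, 8k, 0 and 8(k + 1) on the classes j = 4k + 1, 4k + 2, 4k + 3, 4k + 4.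

module Submission where

open import Defs
open import Data.Nat using (ℕ; zero; suc; NonZero; _*_; _+_; _∸_; _≤_; _<_; _≟_; z<s; s≤s)
open import Data.Nat.Properties
  using (_≤?_; ≤-reflexive; ≤-trans; ≤-antisym; <⇒≤; ≰⇒>; <-irrefl; <-trans; <-≤-trans; ≤-<-trans;
         n<1+n; n≤1+n; 0≢1+n; m<m+n; +-comm; +-suc; +-mono-≤; *-comm; *-monoˡ-≤; *-distribˡ-+;
         *-cancelˡ-≡; *-cancelˡ-<; +-∸-assoc; m+n∸m≡n; m≤n⇒m∸n≡0; 0∸n≡0)
open import Data.Nat.DivMod using (_%_; m*n%n≡0; [m+kn]%n≡m%n)
import Data.Nat.Tactic.RingSolver as ℕ-Solver
open import Data.Integer as ℤ using (ℤ; +_; 1ℤ; -1ℤ)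
import Data.Integer.Properties as ℤ
import Data.Integer.Tactic.RingSolver as ℤ-Solver
open import Data.Rational as ℚ using (_/_; toℚᵘ)
open import Data.Rational.Properties using (toℚᵘ-homo-+; toℚᵘ-fromℚᵘ; toℚᵘ-cong; toℚᵘ-injective)
open import Data.Rational.Unnormalised as ℚᵘ using (ℚᵘ; mkℚᵘ; *≡*; _≃_)
import Data.Rational.Unnormalised.Properties as ℚᵘ
open import Data.List using (List; []; _∷_; [_]; _++_; map; filter; length; concatMap; upTo)
open import Data.List.Properties
  using (map-++; upTo-∷ʳ; concatMap-++; ++-identityʳ; length-++; filter-++; filter-accept; filter-reject;
         filter-none; filter-≐)
open import Data.List.Relation.Unary.All using (universal)
open import Data.Product using (_×_; _,_; proj₁; proj₂)
open import Function using (_∘_; _⇔_; mk⇔; Equivalence)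
open import Relation.Nullary using (yes; no; contradiction)
open import Relation.Unary using (Pred; Decidable)
open import Relation.Binary.PropositionalEquality
  using (_≡_; _≢_; refl; sym; trans; cong; cong₂; module ≡-Reasoning)
open ≡-Reasoning

length-filter-map : ∀ {a b p} {A : Set a} {B : Set b} {P : Pred A p} (P? : Decidable P) (g : B → A) xs →
                    length (filter P? (map g xs)) ≡ length (filter (P? ∘ g) xs)
length-filter-map P? g [] = refl
length-filter-map P? g (x ∷ xs) with P? (g x)
... | yes _ = cong suc (length-filter-map P? g xs)
... | no  _ = length-filter-map P? g xs

length-filter-∷ʳ : ∀ {a p} {A : Set a} {P : Pred A p} (P? : Decidable P) xs (x : A) →
                   length (filter P? (xs ++ [ x ])) ≡ length (filter P? xs) + length (filter P? [ x ])
length-filter-∷ʳ P? xs x = trans (cong length (filter-++ P? xs [ x ])) (length-++ (filter P? xs))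

oneTo-suc : ∀ n → oneTo (suc n) ≡ oneTo n ++ [ suc n ]
oneTo-suc n = trans (cong (map suc) (sym (upTo-∷ʳ n))) (map-++ suc (upTo n) [ n ])

twoSubsets-suc : ∀ n → twoSubsets (suc n) ≡ twoSubsets n ++ map (_, suc n) (oneTo n)
twoSubsets-suc n = begin
  concatMap pairsWith (oneTo (suc n))                      ≡⟨ cong (concatMap pairsWith) (oneTo-suc n) ⟩
  concatMap pairsWith (oneTo n ++ [ suc n ])               ≡⟨ concatMap-++ pairsWith (oneTo n) [ suc n ] ⟩
  twoSubsets n ++ (map (_, suc n) (oneTo n) ++ [])         ≡⟨ cong (twoSubsets n ++_) (++-identityʳ _) ⟩
  twoSubsets n ++ map (_, suc n) (oneTo n)                 ∎
  where
  pairsWith : ℕ → List (ℕ × ℕ)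
  pairsWith n₂ = map (_, n₂) (oneTo (n₂ ∸ 1))

solutionsUpTo : (c s n : ℕ) → ℕ
solutionsUpTo c s n = length (filter (λ a → a + c ≟ s) (oneTo n))

module _ {c s : ℕ} where

  private
    solution? : Decidable (λ a → a + c ≡ s)
    solution? a = a + c ≟ s

  solutionsUpTo-suc : ∀ n →
    solutionsUpTo c s (suc n) ≡ solutionsUpTo c s n + length (filter solution? [ suc n ])
  solutionsUpTo-suc n =
    trans (cong (length ∘ filter solution?) (oneTo-suc n)) (length-filter-∷ʳ solution? (oneTo n) (suc n))

  solutionsUpTo≡0 : ∀ n → n + c < s → solutionsUpTo c s n ≡ 0
  solutionsUpTo≡0 zero    _     = refl
  solutionsUpTo≡0 (suc n) n+c<s = trans (solutionsUpTo-suc n) (cong₂ _+_ earlier last)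
    where
    earlier : solutionsUpTo c s n ≡ 0
    earlier = solutionsUpTo≡0 n (<-trans (n<1+n _) n+c<s)
    last : length (filter solution? [ suc n ]) ≡ 0
    last = cong length (filter-reject solution? (λ e → <-irrefl e n+c<s))

  solutionsUpTo≡1 : ∀ n → c < s → s ≤ n + c → solutionsUpTo c s n ≡ 1
  solutionsUpTo≡1 zero    c<s s≤c = contradiction (<-≤-trans c<s s≤c) (<-irrefl refl)
  solutionsUpTo≡1 (suc n) c<s s≤1+n+c with s ≤? n + c
  ... | yes s≤n+c = trans (solutionsUpTo-suc n) (cong₂ _+_ earlier last)
    where
    earlier : solutionsUpTo c s n ≡ 1
    earlier = solutionsUpTo≡1 n c<s s≤n+c
    last : length (filter solution? [ suc n ]) ≡ 0
    last = cong length (filter-reject solution? (λ e → <-irrefl (sym e) (s≤s s≤n+c)))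
  ... | no s≰n+c = trans (solutionsUpTo-suc n) (cong₂ _+_ earlier last)
    where
    earlier : solutionsUpTo c s n ≡ 0
    earlier = solutionsUpTo≡0 n (≰⇒> s≰n+c)
    last : length (filter solution? [ suc n ]) ≡ 1
    last = cong length (filter-accept solution? (≤-antisym (≰⇒> s≰n+c) s≤1+n+c))

pairsWithSum : (n s : ℕ) → ℕ
pairsWithSum n s = length (filter (λ p → proj₁ p + proj₂ p ≟ s) (twoSubsets n))

pairsWithSum-suc : ∀ n s → pairsWithSum (suc n) s ≡ pairsWithSum n s + solutionsUpTo (suc n) s n
pairsWithSum-suc n s = begin
  length (filter sum? (twoSubsets (suc n)))                      ≡⟨ cong (length ∘ filter sum?) (twoSubsets-suc n) ⟩
  length (filter sum? (twoSubsets n ++ newPairs))                ≡⟨ cong length (filter-++ sum? (twoSubsets n) newPairs) ⟩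
  length (filter sum? (twoSubsets n) ++ filter sum? newPairs)    ≡⟨ length-++ (filter sum? (twoSubsets n)) ⟩
  pairsWithSum n s + length (filter sum? newPairs)               ≡⟨ cong (_+_ (pairsWithSum n s))
                                                                       (length-filter-map sum? (_, suc n) (oneTo n)) ⟩
  pairsWithSum n s + solutionsUpTo (suc n) s n                   ∎
  where
  newPairs : List (ℕ × ℕ)
  newPairs = map (_, suc n) (oneTo n)
  sum? : Decidable (λ (p : ℕ × ℕ) → proj₁ p + proj₂ p ≡ s)
  sum? p = proj₁ p + proj₂ p ≟ s

-- The two bounds say h = ⌊s/2⌋; the pairs counted are (s - b, b) with h < b ≤ n.
pairsWithSum-closed : ∀ {h s} n → h + h ≤ s → s ≤ suc (h + h) → n < s → pairsWithSum n s ≡ n ∸ h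
pairsWithSum-closed {h} zero _ _ _ = sym (0∸n≡0 h)
pairsWithSum-closed {h} {s} (suc n) h+h≤s s≤1+h+h 1+n<s
  with ih ← pairsWithSum-closed {h} n h+h≤s s≤1+h+h (<-trans (n<1+n n) 1+n<s) | h ≤? n
... | yes h≤n = begin
  pairsWithSum (suc n) s                        ≡⟨ pairsWithSum-suc n s ⟩
  pairsWithSum n s + solutionsUpTo (suc n) s n  ≡⟨ cong₂ _+_ ih (solutionsUpTo≡1 n 1+n<s s≤n+1+n) ⟩
  (n ∸ h) + 1                                   ≡⟨ +-comm (n ∸ h) 1 ⟩
  1 + (n ∸ h)                                   ≡⟨ +-∸-assoc 1 h≤n ⟨
  suc n ∸ h                                     ∎
  where
  s≤n+1+n : s ≤ n + suc n
  s≤n+1+n = ≤-trans s≤1+h+h (≤-trans (s≤s (+-mono-≤ h≤n h≤n)) (≤-reflexive (sym (+-suc n n))))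
... | no h≰n = begin
  pairsWithSum (suc n) s                        ≡⟨ pairsWithSum-suc n s ⟩
  pairsWithSum n s + solutionsUpTo (suc n) s n  ≡⟨ cong₂ _+_ ih (solutionsUpTo≡0 n n+1+n<s) ⟩
  (n ∸ h) + 0                                   ≡⟨ cong (_+ 0) (m≤n⇒m∸n≡0 (<⇒≤ n<h)) ⟩
  0                                             ≡⟨ m≤n⇒m∸n≡0 n<h ⟨
  suc n ∸ h                                     ∎
  where
  n<h : n < h
  n<h = ≰⇒> h≰n
  n+1+n<s : n + suc n < s
  n+1+n<s = ≤-trans (+-mono-≤ n<h n<h) h+h≤s

cross-multiplied⇔ : ∀ (A B J : ℤ) .{{_ : ℤ.NonZero J}} →
  ((A ℤ.- 1ℤ) ℤ.* J ℤ.+ (B ℤ.- 1ℤ) ℤ.* J) ℤ.* 1ℤ ≡ + 3 ℤ.* (J ℤ.* J) ⇔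
  A ℤ.+ B ≡ + 3 ℤ.* J ℤ.+ + 2
cross-multiplied⇔ A B J = mk⇔ to from
  where
  collect : ((A ℤ.- 1ℤ) ℤ.* J ℤ.+ (B ℤ.- 1ℤ) ℤ.* J) ℤ.* 1ℤ ≡ (A ℤ.+ B ℤ.- + 2) ℤ.* J
  collect = ℤ-Solver.solve (A ∷ B ∷ J ∷ [])
  reassociate : + 3 ℤ.* (J ℤ.* J) ≡ (+ 3 ℤ.* J) ℤ.* J
  reassociate = ℤ-Solver.solve (J ∷ [])

  to : ((A ℤ.- 1ℤ) ℤ.* J ℤ.+ (B ℤ.- 1ℤ) ℤ.* J) ℤ.* 1ℤ ≡ + 3 ℤ.* (J ℤ.* J) →
       A ℤ.+ B ≡ + 3 ℤ.* J ℤ.+ + 2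
  to e = begin
    A ℤ.+ B                  ≡⟨ ℤ-Solver.solve (A ∷ B ∷ []) ⟩
    A ℤ.+ B ℤ.- + 2 ℤ.+ + 2  ≡⟨ cong (ℤ._+ + 2) A+B-2≡3J ⟩
    + 3 ℤ.* J ℤ.+ + 2        ∎
    where
    A+B-2≡3J : A ℤ.+ B ℤ.- + 2 ≡ + 3 ℤ.* J
    A+B-2≡3J = ℤ.*-cancelʳ-≡ _ _ J (trans (sym collect) (trans e reassociate))

  from : A ℤ.+ B ≡ + 3 ℤ.* J ℤ.+ + 2 →
         ((A ℤ.- 1ℤ) ℤ.* J ℤ.+ (B ℤ.- 1ℤ) ℤ.* J) ℤ.* 1ℤ ≡ + 3 ℤ.* (J ℤ.* J)
  from e = begin
    ((A ℤ.- 1ℤ) ℤ.* J ℤ.+ (B ℤ.- 1ℤ) ℤ.* J) ℤ.* 1ℤ  ≡⟨ collect ⟩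
    (A ℤ.+ B ℤ.- + 2) ℤ.* J                          ≡⟨ cong (λ S → (S ℤ.- + 2) ℤ.* J) e ⟩
    (+ 3 ℤ.* J ℤ.+ + 2 ℤ.- + 2) ℤ.* J                ≡⟨ ℤ-Solver.solve (J ∷ []) ⟩
    + 3 ℤ.* (J ℤ.* J)                                ∎

pt+pt≡3⇔ : ∀ j .{{_ : NonZero j}} a b → (pt j a ℚ.+ pt j b ≡ + 3 / 1) ⇔ (2 * (a + b) ≡ 3 * j + 2)
pt+pt≡3⇔ j@(suc j-1) a b = mk⇔ to from
  where
  ptᵘ : ℕ → ℚᵘ
  ptᵘ n = mkℚᵘ (+ (2 * n) ℤ.- 1ℤ) j-1

  toℚᵘ-sum : toℚᵘ (pt j a ℚ.+ pt j b) ≃ ptᵘ a ℚᵘ.+ ptᵘ b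
  toℚᵘ-sum = ℚᵘ.≃-trans (toℚᵘ-homo-+ (pt j a) (pt j b))
                        (ℚᵘ.+-cong (toℚᵘ-fromℚᵘ (ptᵘ a)) (toℚᵘ-fromℚᵘ (ptᵘ b)))

  open Equivalence (cross-multiplied⇔ (+ (2 * a)) (+ (2 * b)) (+ j))
    renaming (to to cross⇒linear; from to linear⇒cross)

  to : pt j a ℚ.+ pt j b ≡ + 3 / 1 → 2 * (a + b) ≡ 3 * j + 2
  to e with ℚᵘ.≃-trans (ℚᵘ.≃-sym toℚᵘ-sum) (toℚᵘ-cong e)
  ... | *≡* cross = trans (*-distribˡ-+ 2 a b) (ℤ.+-injective (cross⇒linear cross))

  from : 2 * (a + b) ≡ 3 * j + 2 → pt j a ℚ.+ pt j b ≡ + 3 / 1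
  from e = toℚᵘ-injective (ℚᵘ.≃-trans toℚᵘ-sum (*≡* (linear⇒cross (cong +_ 2a+2b≡3j+2))))
    where
    2a+2b≡3j+2 : 2 * a + 2 * b ≡ 3 * j + 2
    2a+2b≡3j+2 = trans (sym (*-distribˡ-+ 2 a b)) e

even≢odd : ∀ m n → 2 * m ≢ suc (2 * n)
even≢odd m n e = 0≢1+n (begin
  0                    ≡⟨ sym (m*n%n≡0 m 2) ⟩
  (m * 2) % 2          ≡⟨ cong (_% 2) (trans (*-comm m 2) (trans e (cong suc (*-comm 2 n)))) ⟩
  (1 + n * 2) % 2      ≡⟨ [m+kn]%n≡m%n 1 n 2 ⟩
  1                    ∎)

f≡0 : ∀ j .{{_ : NonZero j}} m → 3 * j + 2 ≡ suc (2 * m) → f j ≡ 0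
f≡0 j m odd = cong length (filter-none _ (universal noSolution (twoSubsets j)))
  where
  noSolution : ∀ p → pt j (proj₁ p) ℚ.+ pt j (proj₂ p) ≢ + 3 / 1
  noSolution (a , b) e = even≢odd (a + b) m (trans (Equivalence.to (pt+pt≡3⇔ j a b) e) odd)

f≡pairsWithSum : ∀ j .{{_ : NonZero j}} s → 3 * j + 2 ≡ 2 * s → f j ≡ pairsWithSum j s
f≡pairsWithSum j s even = cong length (filter-≐ _ _ ((λ {p} → to p) , (λ {p} → from p)) (twoSubsets j))
  where
  to : ∀ p → pt j (proj₁ p) ℚ.+ pt j (proj₂ p) ≡ + 3 / 1 → proj₁ p + proj₂ p ≡ s
  to (a , b) e = *-cancelˡ-≡ (a + b) s 2 (trans (Equivalence.to (pt+pt≡3⇔ j a b) e) even)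
  from : ∀ p → proj₁ p + proj₂ p ≡ s → pt j (proj₁ p) ℚ.+ pt j (proj₂ p) ≡ + 3 / 1
  from (a , b) e = Equivalence.from (pt+pt≡3⇔ j a b) (trans (cong (2 *_) e) (sym even))

f≡j∸h : ∀ j .{{_ : NonZero j}} s h → 3 * j + 2 ≡ 2 * s → h + h ≤ s → s ≤ suc (h + h) → f j ≡ j ∸ h
f≡j∸h j s h 3j+2≡2s h+h≤s s≤1+h+h =
  trans (f≡pairsWithSum j s 3j+2≡2s) (pairsWithSum-closed {h} j h+h≤s s≤1+h+h j<s)
  where
  2j<2s : 2 * j < 2 * s
  2j<2s = <-≤-trans (≤-<-trans (*-monoˡ-≤ j (n≤1+n 2)) (m<m+n (3 * j) z<s)) (≤-reflexive 3j+2≡2s)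
  j<s : j < s
  j<s = *-cancelˡ-< 2 j s 2j<2s

data Residue4 : ℕ → Set where
  4k+1 : ∀ k → Residue4 (1 + k * 4)
  4k+2 : ∀ k → Residue4 (2 + k * 4)
  4k+3 : ∀ k → Residue4 (3 + k * 4)
  4k+4 : ∀ k → Residue4 (4 + k * 4)

residue4 : ∀ n → Residue4 (suc n)
residue4 0 = 4k+1 0
residue4 1 = 4k+2 0
residue4 2 = 4k+3 0
residue4 3 = 4k+4 0
residue4 (suc (suc (suc (suc n)))) with residue4 n
... | 4k+1 k = 4k+1 (suc k)
... | 4k+2 k = 4k+2 (suc k)
... | 4k+3 k = 4k+3 (suc k)
... | 4k+4 k = 4k+4 (suc k)

f[4k+1]≡0 : ∀ k → f (1 + k * 4) ≡ 0
f[4k+1]≡0 k = f≡0 (1 + k * 4) (6 * k + 2) (ℕ-Solver.solve (k ∷ []))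

f[4k+3]≡0 : ∀ k → f (3 + k * 4) ≡ 0
f[4k+3]≡0 k = f≡0 (3 + k * 4) (6 * k + 5) (ℕ-Solver.solve (k ∷ []))

f[4k+2]≡k : ∀ k → f (2 + k * 4) ≡ k
f[4k+2]≡k k = begin
  f (2 + k * 4)                  ≡⟨ f≡j∸h (2 + k * 4) (6 * k + 4) (3 * k + 2) (ℕ-Solver.solve (k ∷ []))
                                          (≤-reflexive h+h≡s) (≤-trans (≤-reflexive (sym h+h≡s)) (n≤1+n _)) ⟩
  (2 + k * 4) ∸ (3 * k + 2)      ≡⟨ cong (_∸ (3 * k + 2)) (ℕ-Solver.solve (k ∷ [])) ⟩
  (3 * k + 2) + k ∸ (3 * k + 2)  ≡⟨ m+n∸m≡n (3 * k + 2) k ⟩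
  k                              ∎
  where
  h+h≡s : (3 * k + 2) + (3 * k + 2) ≡ 6 * k + 4
  h+h≡s = ℕ-Solver.solve (k ∷ [])

f[4k+4]≡1+k : ∀ k → f (4 + k * 4) ≡ suc k
f[4k+4]≡1+k k = begin
  f (4 + k * 4)                      ≡⟨ f≡j∸h (4 + k * 4) (6 * k + 7) (3 * k + 3) (ℕ-Solver.solve (k ∷ []))
                                              (≤-trans (n≤1+n _) (≤-reflexive 1+h+h≡s))
                                              (≤-reflexive (sym 1+h+h≡s)) ⟩
  (4 + k * 4) ∸ (3 * k + 3)          ≡⟨ cong (_∸ (3 * k + 3)) (ℕ-Solver.solve (k ∷ [])) ⟩
  (3 * k + 3) + suc k ∸ (3 * k + 3)  ≡⟨ m+n∸m≡n (3 * k + 3) (suc k) ⟩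
  suc k                              ∎
  where
  1+h+h≡s : suc ((3 * k + 3) + (3 * k + 3)) ≡ 6 * k + 7
  1+h+h≡s = ℕ-Solver.solve (k ∷ [])

u⁴≡1⇒u^[k*4]≡1 : ∀ u → u ^ᵍ 4 ≡ ι 1 → ∀ k → u ^ᵍ (k * 4) ≡ ι 1
u⁴≡1⇒u^[k*4]≡1 u u⁴≡1 zero    = refl
u⁴≡1⇒u^[k*4]≡1 u u⁴≡1 (suc k) =
  trans (cong (λ v → u ⊗ (u ⊗ (u ⊗ (u ⊗ v)))) (u⁴≡1⇒u^[k*4]≡1 u u⁴≡1 k)) u⁴≡1

u⁴≡1⇒u^[r+k*4]≡u^r : ∀ u → u ^ᵍ 4 ≡ ι 1 → ∀ r k → u ^ᵍ (r + k * 4) ≡ u ^ᵍ r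
u⁴≡1⇒u^[r+k*4]≡u^r u u⁴≡1 zero    k = u⁴≡1⇒u^[k*4]≡1 u u⁴≡1 k
u⁴≡1⇒u^[r+k*4]≡u^r u u⁴≡1 (suc r) k = cong (u ⊗_) (u⁴≡1⇒u^[r+k*4]≡u^r u u⁴≡1 r k)

-- The right-hand side of the theorem is rhsAt j j; separating the exponent p from the
-- linear term j lets the powers be reduced modulo 4 while j stays put.
rhsAt : ℕ → ℕ → ℤ[i]
rhsAt p j = (-1ᵍ ^ᵍ (1 + p)) ⊖ ι 1 ⊕ ((⊝ 𝕚) ^ᵍ p) ⊕ (𝕚 ^ᵍ p) ⊕ ((-1ᵍ ^ᵍ p) ⊗ ι j) ⊕ ι j

rhsAt-periodic : ∀ r k j → rhsAt (r + k * 4) j ≡ rhsAt r j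
rhsAt-periodic r k j
  rewrite u⁴≡1⇒u^[r+k*4]≡u^r (⊝ 𝕚) refl r k
        | u⁴≡1⇒u^[r+k*4]≡u^r 𝕚 refl r k
        | u⁴≡1⇒u^[r+k*4]≡u^r -1ᵍ refl r k
        = refl

re-rhsAt : ∀ p j → re (rhsAt p j) ≡
  re (-1ᵍ ^ᵍ (1 + p)) ℤ.- 1ℤ ℤ.+ re ((⊝ 𝕚) ^ᵍ p) ℤ.+ re (𝕚 ^ᵍ p) ℤ.+ re (-1ᵍ ^ᵍ p) ℤ.* + j ℤ.+ + j
re-rhsAt p j =
  expand (re (-1ᵍ ^ᵍ (1 + p))) (re ((⊝ 𝕚) ^ᵍ p)) (re (𝕚 ^ᵍ p)) (re (-1ᵍ ^ᵍ p)) (im (-1ᵍ ^ᵍ p)) (+ j)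
  where
  expand : ∀ A B C D E J →
    A ℤ.+ ℤ.- (+ 1) ℤ.+ B ℤ.+ C ℤ.+ (D ℤ.* J ℤ.- E ℤ.* + 0) ℤ.+ J ≡ A ℤ.- 1ℤ ℤ.+ B ℤ.+ C ℤ.+ D ℤ.* J ℤ.+ J
  expand = ℤ-Solver.solve-∀

-- The real part given by re-rhsAt for p = 1 and for p = 3, once the closed powers are computed.
odd-terms-cancel : ∀ J → + 1 ℤ.- 1ℤ ℤ.+ + 0 ℤ.+ + 0 ℤ.+ -1ℤ ℤ.* J ℤ.+ J ≡ + 0
odd-terms-cancel = ℤ-Solver.solve-∀

rhsAt[1]≡0 : ∀ j → rhsAt 1 j ≡ ι 0
rhsAt[1]≡0 j = cong₂ _+_i (trans (re-rhsAt 1 j) (odd-terms-cancel (+ j))) refl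

rhsAt[3]≡0 : ∀ j → rhsAt 3 j ≡ ι 0
rhsAt[3]≡0 j = cong₂ _+_i (trans (re-rhsAt 3 j) (odd-terms-cancel (+ j))) refl

rhsAt[2]≡8k : ∀ k → rhsAt 2 (2 + k * 4) ≡ ι (8 * k)
rhsAt[2]≡8k k = cong₂ _+_i re-part refl
  where
  collect : ∀ J K → J ≡ + 2 ℤ.+ K ℤ.* + 4 → -1ℤ ℤ.- 1ℤ ℤ.+ -1ℤ ℤ.+ -1ℤ ℤ.+ 1ℤ ℤ.* J ℤ.+ J ≡ + 8 ℤ.* K
  collect _ K refl = ℤ-Solver.solve (K ∷ [])
  re-part : re (rhsAt 2 (2 + k * 4)) ≡ + (8 * k)
  re-part = trans (re-rhsAt 2 (2 + k * 4))
                  (trans (collect _ (+ k) (cong (ℤ._+_ (+ 2)) (ℤ.pos-* k 4))) (sym (ℤ.pos-* 8 k)))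

rhsAt[4]≡8[k+1] : ∀ k → rhsAt 4 (4 + k * 4) ≡ ι (8 * suc k)
rhsAt[4]≡8[k+1] k = cong₂ _+_i re-part refl
  where
  collect : ∀ J K → J ≡ K ℤ.* + 4 → -1ℤ ℤ.- 1ℤ ℤ.+ 1ℤ ℤ.+ 1ℤ ℤ.+ 1ℤ ℤ.* J ℤ.+ J ≡ + 8 ℤ.* K
  collect _ K refl = ℤ-Solver.solve (K ∷ [])
  re-part : re (rhsAt 4 (4 + k * 4)) ≡ + (8 * suc k)
  re-part = trans (re-rhsAt 4 (4 + k * 4))
                  (trans (collect _ (+ suc k) (ℤ.pos-* (suc k) 4)) (sym (ℤ.pos-* 8 (suc k))))

lemma7p4 : (j : ℕ) → .{{_ : NonZero j}} →
    ι (8 * f j) ≡ (-1ᵍ ^ᵍ (1 + j)) ⊖ ι 1 ⊕ ((⊝ 𝕚) ^ᵍ j) ⊕ (𝕚 ^ᵍ j) ⊕ ((-1ᵍ ^ᵍ j) ⊗ ι j) ⊕ ι j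
lemma7p4 j@(suc n) with residue4 n
... | 4k+1 k = trans (cong (ι ∘ (8 *_)) (f[4k+1]≡0 k))   (sym (trans (rhsAt-periodic 1 k j) (rhsAt[1]≡0 j)))
... | 4k+2 k = trans (cong (ι ∘ (8 *_)) (f[4k+2]≡k k))   (sym (trans (rhsAt-periodic 2 k j) (rhsAt[2]≡8k k)))
... | 4k+3 k = trans (cong (ι ∘ (8 *_)) (f[4k+3]≡0 k))   (sym (trans (rhsAt-periodic 3 k j) (rhsAt[3]≡0 j)))
... | 4k+4 k = trans (cong (ι ∘ (8 *_)) (f[4k+4]≡1+k k)) (sym (trans (rhsAt-periodic 4 k j) (rhsAt[4]≡8[k+1] k)))
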